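{- Let $N\geq k\geq 2$ be integers, and let $p\geq 2$ be the unique integer with $k\binom{p}{2}\leq N<k\binom{p+1}{2}$. Write $N=k\binom{p}{2}+qp+r$ with integers $0\leq q<k$ and $0\leq r<p$. Then $$M^{\mathsf{L}}(k,N)=\begin{cases} kp-k+q & \text{if } r\leq (p-1)/2,\\ kp-k+q+1-\frac{2(p-r)}{p+1} & \text{if } r\geq (p-1)/2.\end{cases}$$
   Context: For a finite graph $G$, the maximum average degree is $\mathrm{Mad}(G)=\max\{2e(H)/|V(H)| : H\subseteq G,\ |V(H)|\geq 1\}$, where $e(H)$ is the number of edges (so $\mathrm{Mad}(G)=0$ if $G$ has no edges). A list of $k$ graphs is a multiset $\{G_1,\dots,G_k\}$ of finite graphs (repetitions allowed). For positive integers $k,N$, $M^{\mathsf{L}}(k,N)=\max\{\sum_{j=1}^k \mathrm{Mad}(G_j)\}$, the maximum taken over all lists of $k$ graphs with $\sum_{j=1}^k e(G_j)=N$. -}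

module Defs where

open import Data.Nat as ℕ using (ℕ; zero; suc; NonZero)
open import Data.Fin using (Fin; toℕ)
open import Data.Integer using (+_)
open import Data.Rational as ℚ using (ℚ; _≤_; _/_; 0ℚ)
open import Data.Product using (Σ; _×_; _,_; ∃; ∃-syntax)
open import Data.Sum using (_⊎_)
open import Data.List using (List; length)
open import Data.List.Relation.Unary.All using (All)
open import Data.List.Relation.Unary.Unique.Propositional using (Unique)
open import Data.List.Membership.Propositional using (_∈_)
open import Data.Vec using (Vec; lookup; foldr′)
open import Function.Definitions using (Injective)
open import Relation.Binary.PropositionalEquality using (_≡_)

-- A finite simple graph on vertex set Fin n.  Each edge {i,j} is stored
-- once as the ordered pair (i , j) with i < j; the edge list has no
-- repetitions.  So no loops and no multiple edges.
record Graph : Set where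
  field
    n       : ℕ
    edges   : List (Fin n × Fin n)
    ordered : All (λ ij → toℕ (Data.Product.proj₁ ij) ℕ.< toℕ (Data.Product.proj₂ ij)) edges
    simple  : Unique edges
open Graph public

e : Graph → ℕ
e G = length (edges G)

_⊆G_ : Graph → Graph → Set
H ⊆G G = Σ (Fin (n H) → Fin (n G)) λ f → Injective _≡_ _≡_ f ×
  All (λ ij → ((f (Data.Product.proj₁ ij) , f (Data.Product.proj₂ ij)) ∈ edges G)
            ⊎ ((f (Data.Product.proj₂ ij) , f (Data.Product.proj₁ ij)) ∈ edges G))
      (edges H)

avgDeg : (H : Graph) → NonZero (n H) → ℚ
avgDeg H nz = ((+ (2 ℕ.* e H)) / n H) {{nz}}

-- IsMad G m : m = Mad(G) = max { 2e(H)/|V(H)| : H ⊆ G, |V(H)| ≥ 1 },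
-- with Mad(G) = 0 when this set is empty (or all values are 0).
-- m is an upper bound of all values, and is either attained or equal to 0.
IsMad : Graph → ℚ → Set
IsMad G m =
  (∀ (H : Graph) (nz : NonZero (n H)) → H ⊆G G → avgDeg H nz ≤ m) ×
  (m ≡ 0ℚ ⊎ Σ Graph λ H → Σ (NonZero (n H)) λ nz → H ⊆G G × avgDeg H nz ≡ m)

sumℕ : ∀ {k} → Vec ℕ k → ℕ
sumℕ = foldr′ ℕ._+_ 0

sumℚ : ∀ {k} → Vec ℚ k → ℚ
sumℚ = foldr′ ℚ._+_ 0ℚ

totalEdges : ∀ {k} → Vec Graph k → ℕ
totalEdges Gs = sumℕ (Data.Vec.map e Gs)

-- IsML k N v : v = M^L(k,N), the maximum of Σ Mad(G_j) over lists
-- G_1..G_k of graphs with Σ e(G_j) = N.  (ms j plays the role of Mad(G_j).)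
IsML : ℕ → ℕ → ℚ → Set
IsML k N v =
  (∀ (Gs : Vec Graph k) (ms : Vec ℚ k) → totalEdges Gs ≡ N →
     (∀ j → IsMad (lookup Gs j) (lookup ms j)) → sumℚ ms ≤ v) ×
  (Σ (Vec Graph k) λ Gs → Σ (Vec ℚ k) λ ms → totalEdges Gs ≡ N ×
     (∀ j → IsMad (lookup Gs j) (lookup ms j)) × sumℚ ms ≡ v)

{-# OPTIONS --safe #-}
-- For p ≥ 1 put Φ_p(x) = (p+1)⌊x/p⌋ + max(0, 2(x mod p) + 1 - p).  Every graph G satisfies
-- (p+1)·Mad(G) ≤ Φ_p(e(G) + C(p,2)): writing e(G) + C(p,2) = Mp + ρ, a subgraph on at most M+1
-- vertices has average degree at most M, while a larger one has average degree at most 2e(G)/(M+2),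
-- which a quadratic inequality bounds.  As Φ_p is superadditive, a list of k graphs with N edges
-- has (p+1)·Σ Mad(G_j) ≤ Φ_p(N + k·C(p,2)) = (p+1)(k(p-1) + q) + max(0, 2r + 1 - p).  Equality
-- holds for q copies of K_{p+1}, one K_p plus a vertex joined to r of its vertices, and k-q-1
-- copies of K_p plus an isolated vertex.
module Submission where

open import Defs
open import Data.Nat using (ℕ; zero; suc; _+_; _*_; _∸_; _⊓_; _≤_; _<_; _≤?_; _<?_; z≤n; s≤s; s≤s⁻¹; NonZero; >-nonZero; >-nonZero⁻¹)
open import Data.Nat.Properties
open import Data.Nat.DivMod using (_%_; m≡m%n+[m/n]*n; m%n<n; +-distrib-/-∣ˡ; m*n/n≡m; m<n⇒m/n≡0; [m+kn]%n≡m%n; m<n⇒m%n≡m)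
  renaming (_/_ to _div_)
open import Data.Nat.Divisibility using (n∣m*n)
open import Data.Nat.Combinatorics using (_C_; nC1≡n; nCk+nC[k+1]≡[n+1]C[k+1])
open import Data.Nat.Tactic.RingSolver using (solve-∀)
open import Data.Integer as ℤ using (+_)
open import Data.Integer.Properties using (pos-+; pos-*)
import Data.Integer.Tactic.RingSolver as ℤ-Solver
open import Data.Rational as ℚ using (ℚ; _/_; _-_; 0ℚ)
import Data.Rational.Properties as ℚP
open import Data.Rational.Unnormalised as ℚᵘ using (mkℚᵘ; *≡*; *≤*)
import Data.Rational.Unnormalised.Properties as ℚᵘP
open import Data.Fin as Fin using (Fin; toℕ; inject₁; fromℕ)
open import Data.Fin.Properties using (injective⇒≤; inject₁-injective; fromℕ≢inject₁; toℕ-inject₁; toℕ-fromℕ; toℕ<n)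
open import Data.Fin.Relation.Unary.Top using (view; ‵fromℕ; ‵inject₁)
open import Data.List as List using (List; []; _∷_; _++_; length; allFin; take)
open import Data.List.Properties using (length-map; length-++; length-take; length-tabulate)
open import Data.List.Relation.Unary.All as All using (All; []; _∷_)
import Data.List.Relation.Unary.All.Properties as All
open import Data.List.Relation.Unary.Any using (index)
open import Data.List.Relation.Unary.Any.Properties using (lookup-index)
open import Data.List.Relation.Unary.AllPairs using ([]; _∷_)
open import Data.List.Relation.Unary.Unique.Propositional using (Unique)
import Data.List.Relation.Unary.Unique.Propositional.Properties as Unique
open import Data.List.Membership.Propositional using (_∈_)
open import Data.List.Membership.Propositional.Properties using (∈-map⁺; ∈-map⁻; ∈-++⁺ˡ; ∈-++⁺ʳ; ∈-allFin; ∈-lookup)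
open import Data.Vec as Vec using (Vec; []; _∷_; lookup)
open import Data.Product using (Σ; _×_; _,_; proj₁; proj₂)
open import Data.Sum using (_⊎_; inj₁; inj₂)
open import Data.Empty using (⊥-elim)
open import Function.Definitions using (Injective)
open import Relation.Binary.PropositionalEquality
open import Relation.Nullary using (Dec; yes; no; ¬_)

suc[n]C2 : ∀ n → suc n C 2 ≡ n C 2 + n
suc[n]C2 n = begin
  suc n C 2     ≡⟨ nCk+nC[k+1]≡[n+1]C[k+1] n 1 ⟨
  n C 1 + n C 2 ≡⟨ cong (_+ n C 2) (nC1≡n n) ⟩
  n + n C 2     ≡⟨ +-comm n (n C 2) ⟩
  n C 2 + n     ∎
  where open ≡-Reasoning

2*nC2+n≡n*n : ∀ n → 2 * (n C 2) + n ≡ n * n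
2*nC2+n≡n*n zero    = refl
2*nC2+n≡n*n (suc n) = begin
  2 * (suc n C 2) + suc n       ≡⟨ cong (λ c → 2 * c + suc n) (suc[n]C2 n) ⟩
  2 * (n C 2 + n) + suc n       ≡⟨ regroup (n C 2) n ⟩
  2 * (n C 2) + n + (2 * n + 1) ≡⟨ cong (_+ (2 * n + 1)) (2*nC2+n≡n*n n) ⟩
  n * n + (2 * n + 1)           ≡⟨ square n ⟩
  suc n * suc n                 ∎
  where
  open ≡-Reasoning
  regroup : ∀ c n → 2 * (c + n) + suc n ≡ 2 * c + n + (2 * n + 1)
  regroup = solve-∀
  square : ∀ n → n * n + (2 * n + 1) ≡ suc n * suc n
  square = solve-∀

2*nC2≡[n∸1]*n : ∀ n → 2 * (n C 2) ≡ (n ∸ 1) * n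
2*nC2≡[n∸1]*n zero    = refl
2*nC2≡[n∸1]*n (suc n) = +-cancelʳ-≡ (suc n) _ _
  (trans (2*nC2+n≡n*n (suc n)) (+-comm (suc n) (n * suc n)))

-- The potential Φ_p

m∸o+n∸o≤[m+n]∸o : ∀ m n o → (m ∸ o) + (n ∸ o) ≤ (m + n) ∸ o
m∸o+n∸o≤[m+n]∸o m n o with o ≤? n
... | yes o≤n = begin
  (m ∸ o) + (n ∸ o) ≤⟨ +-monoˡ-≤ (n ∸ o) (m∸n≤m m o) ⟩
  m + (n ∸ o)       ≡⟨ +-∸-assoc m o≤n ⟨
  (m + n) ∸ o       ∎
  where open ≤-Reasoning
... | no o≰n = begin
  (m ∸ o) + (n ∸ o) ≡⟨ cong (_+_ (m ∸ o)) (m≤n⇒m∸n≡0 (<⇒≤ (≰⇒> o≰n))) ⟩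
  (m ∸ o) + 0       ≡⟨ +-identityʳ (m ∸ o) ⟩
  m ∸ o             ≤⟨ ∸-monoˡ-≤ o (m≤m+n m n) ⟩
  (m + n) ∸ o       ∎
  where open ≤-Reasoning

[m*n+o]/n≡m : ∀ m n o .{{_ : NonZero n}} → o < n → (m * n + o) div n ≡ m
[m*n+o]/n≡m m n o o<n = begin
  (m * n + o) div n         ≡⟨ +-distrib-/-∣ˡ o (n∣m*n m) ⟩
  m * n div n + o div n     ≡⟨ cong₂ _+_ (m*n/n≡m m n) (m<n⇒m/n≡0 o<n) ⟩
  m + 0                     ≡⟨ +-identityʳ m ⟩
  m                         ∎
  where open ≡-Reasoning

[m*n+o]%n≡o : ∀ m n o .{{_ : NonZero n}} → o < n → (m * n + o) % n ≡ o
[m*n+o]%n≡o m n o o<n = begin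
  (m * n + o) % n ≡⟨ cong (_% n) (+-comm (m * n) o) ⟩
  (o + m * n) % n ≡⟨ [m+kn]%n≡m%n o m n ⟩
  o % n           ≡⟨ m<n⇒m%n≡m o<n ⟩
  o               ∎
  where open ≡-Reasoning

excess : ℕ → ℕ → ℕ
excess p ρ = suc (2 * ρ) ∸ p

potential : ∀ p .{{_ : NonZero p}} → ℕ → ℕ
potential p x = suc p * (x div p) + excess p (x % p)

excess-zero : ∀ p .{{_ : NonZero p}} → excess p 0 ≡ 0
excess-zero (suc p) = 0∸n≡0 p

excess-self : ∀ p → excess p p ≡ suc p
excess-self p = begin
  suc (2 * p) ∸ p   ≡⟨ cong (_∸ p) (shape p) ⟩
  (p + suc p) ∸ p   ≡⟨ m+n∸m≡n p (suc p) ⟩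
  suc p             ∎
  where
  open ≡-Reasoning
  shape : ∀ p → suc (2 * p) ≡ p + suc p
  shape = solve-∀

excess≤ : ∀ {p ρ} → ρ < p → excess p ρ ≤ p
excess≤ {p} {ρ} ρ<p = begin
  suc (2 * ρ) ∸ p ≤⟨ ∸-monoˡ-≤ p (≤-trans (n≤1+n _) (≤-trans (≤-reflexive (sym (*-suc 2 ρ))) (*-monoʳ-≤ 2 ρ<p))) ⟩
  2 * p ∸ p       ≡⟨ cong (λ m → p + m ∸ p) (+-identityʳ p) ⟩
  (p + p) ∸ p     ≡⟨ m+n∸n≡m p p ⟩
  p               ∎
  where open ≤-Reasoning

excess-superadditive : ∀ p a b .{{_ : NonZero p}} → excess p a + excess p b ≤ excess p (a + b)
excess-superadditive (suc p) a b = begin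
  (2 * a ∸ p) + (2 * b ∸ p) ≤⟨ m∸o+n∸o≤[m+n]∸o (2 * a) (2 * b) p ⟩
  (2 * a + 2 * b) ∸ p       ≡⟨ cong (_∸ p) (*-distribˡ-+ 2 a b) ⟨
  2 * (a + b) ∸ p           ∎
  where open ≤-Reasoning

excess-sum : ∀ p {ρ₁ ρ₂ s} → p ≤ suc (2 * ρ₁) → p ≤ suc (2 * ρ₂) → ρ₁ + ρ₂ ≡ p + s →
             excess p ρ₁ + excess p ρ₂ ≡ suc (suc (2 * s))
excess-sum p {ρ₁} {ρ₂} {s} p≤₁ p≤₂ carry = +-cancelʳ-≡ (p + p) _ _ (begin
  excess p ρ₁ + excess p ρ₂ + (p + p)   ≡⟨ shuffle (excess p ρ₁) (excess p ρ₂) p ⟩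
  (excess p ρ₁ + p) + (excess p ρ₂ + p) ≡⟨ cong₂ _+_ (m∸n+n≡m p≤₁) (m∸n+n≡m p≤₂) ⟩
  suc (2 * ρ₁) + suc (2 * ρ₂)           ≡⟨ double ρ₁ ρ₂ ⟩
  2 + 2 * (ρ₁ + ρ₂)                     ≡⟨ cong (λ x → 2 + 2 * x) carry ⟩
  2 + 2 * (p + s)                       ≡⟨ spread p s ⟩
  suc (suc (2 * s)) + (p + p)           ∎)
  where
  open ≡-Reasoning
  shuffle : ∀ a b p → a + b + (p + p) ≡ (a + p) + (b + p)
  shuffle = solve-∀
  double : ∀ c d → suc (2 * c) + suc (2 * d) ≡ 2 + 2 * (c + d)
  double = solve-∀
  spread : ∀ p s → 2 + 2 * (p + s) ≡ suc (suc (2 * s)) + (p + p)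
  spread = solve-∀

excess-carry : ∀ p {ρ₁ ρ₂ s} → ρ₁ < p → ρ₂ < p → ρ₁ + ρ₂ ≡ p + s →
               excess p ρ₁ + excess p ρ₂ ≤ suc p + excess p s
excess-carry p {ρ₁} {ρ₂} {s} ρ₁<p ρ₂<p carry with p ≤? suc (2 * ρ₁) | p ≤? suc (2 * ρ₂)
... | yes p≤₁ | yes p≤₂ = begin
  excess p ρ₁ + excess p ρ₂ ≡⟨ excess-sum p {ρ₁} {ρ₂} p≤₁ p≤₂ carry ⟩
  suc (suc (2 * s))         ≤⟨ s≤s (m≤n+m∸n (suc (2 * s)) p) ⟩
  suc p + excess p s        ∎
  where open ≤-Reasoning
... | no p≰₁ | _ = begin
  excess p ρ₁ + excess p ρ₂ ≡⟨ cong (_+ excess p ρ₂) (m≤n⇒m∸n≡0 (<⇒≤ (≰⇒> p≰₁))) ⟩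
  excess p ρ₂               ≤⟨ excess≤ ρ₂<p ⟩
  p                         ≤⟨ ≤-trans (n≤1+n p) (m≤m+n (suc p) (excess p s)) ⟩
  suc p + excess p s        ∎
  where open ≤-Reasoning
... | yes _ | no p≰₂ = begin
  excess p ρ₁ + excess p ρ₂ ≡⟨ cong (_+_ (excess p ρ₁)) (m≤n⇒m∸n≡0 (<⇒≤ (≰⇒> p≰₂))) ⟩
  excess p ρ₁ + 0           ≡⟨ +-identityʳ (excess p ρ₁) ⟩
  excess p ρ₁               ≤⟨ excess≤ ρ₁<p ⟩
  p                         ≤⟨ ≤-trans (n≤1+n p) (m≤m+n (suc p) (excess p s)) ⟩
  suc p + excess p s        ∎
  where open ≤-Reasoning

potential-≡ : ∀ p M ρ .{{_ : NonZero p}} → ρ < p → potential p (M * p + ρ) ≡ suc p * M + excess p ρ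
potential-≡ p M ρ ρ<p =
  cong₂ (λ q r → suc p * q + excess p r) ([m*n+o]/n≡m M p ρ ρ<p) ([m*n+o]%n≡o M p ρ ρ<p)

potential-≡′ : ∀ p M ρ .{{_ : NonZero p}} → ρ ≤ p → potential p (M * p + ρ) ≡ suc p * M + excess p ρ
potential-≡′ p M ρ ρ≤p with m≤n⇒m<n∨m≡n ρ≤p
... | inj₁ ρ<p = potential-≡ p M ρ ρ<p
... | inj₂ refl = begin
  potential p (M * p + p)     ≡⟨ cong (potential p) (carry M p) ⟩
  potential p (suc M * p + 0) ≡⟨ potential-≡ p (suc M) 0 (>-nonZero⁻¹ p) ⟩
  suc p * suc M + excess p 0  ≡⟨ cong (_+_ (suc p * suc M)) (excess-zero p) ⟩
  suc p * suc M + 0           ≡⟨ unfold p M ⟩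
  suc p * M + suc p           ≡⟨ cong (_+_ (suc p * M)) (excess-self p) ⟨
  suc p * M + excess p p      ∎
  where
  open ≡-Reasoning
  carry : ∀ M p → M * p + p ≡ suc M * p + 0
  carry = solve-∀
  unfold : ∀ p M → suc p * suc M + 0 ≡ suc p * M + suc p
  unfold = solve-∀

potential-merge : ∀ p M {ρ₁ ρ₂} .{{_ : NonZero p}} → ρ₁ < p → ρ₂ < p →
                  suc p * M + (excess p ρ₁ + excess p ρ₂) ≤ potential p (M * p + (ρ₁ + ρ₂))
potential-merge p M {ρ₁} {ρ₂} ρ₁<p ρ₂<p with ρ₁ + ρ₂ <? p
... | yes no-carry = begin
  suc p * M + (excess p ρ₁ + excess p ρ₂) ≤⟨ +-monoʳ-≤ (suc p * M) (excess-superadditive p ρ₁ ρ₂) ⟩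
  suc p * M + excess p (ρ₁ + ρ₂)          ≡⟨ potential-≡ p M (ρ₁ + ρ₂) no-carry ⟨
  potential p (M * p + (ρ₁ + ρ₂))         ∎
  where open ≤-Reasoning
... | no carry = begin
  suc p * M + (excess p ρ₁ + excess p ρ₂) ≤⟨ +-monoʳ-≤ (suc p * M) (excess-carry p ρ₁<p ρ₂<p ρ₁+ρ₂≡) ⟩
  suc p * M + (suc p + excess p s)        ≡⟨ carry-out (suc p) M (excess p s) ⟩
  suc p * suc M + excess p s              ≡⟨ potential-≡ p (suc M) s s<p ⟨
  potential p (suc M * p + s)             ≡⟨ cong (potential p) (trans (cong (_+_ (M * p)) ρ₁+ρ₂≡) (carry-in M p s)) ⟨
  potential p (M * p + (ρ₁ + ρ₂))         ∎
  where
  open ≤-Reasoning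
  s = ρ₁ + ρ₂ ∸ p
  ρ₁+ρ₂≡ : ρ₁ + ρ₂ ≡ p + s
  ρ₁+ρ₂≡ = sym (m+[n∸m]≡n (≮⇒≥ carry))
  s<p : s < p
  s<p = +-cancelˡ-< p s p (subst (_< p + p) ρ₁+ρ₂≡ (+-mono-< ρ₁<p ρ₂<p))
  carry-out : ∀ a M e → a * M + (a + e) ≡ a * suc M + e
  carry-out = solve-∀
  carry-in : ∀ M p s → M * p + (p + s) ≡ suc M * p + s
  carry-in = solve-∀

potential-superadditive : ∀ p x y .{{_ : NonZero p}} → potential p x + potential p y ≤ potential p (x + y)
potential-superadditive p x y = begin
  potential p x + potential p y                        ≡⟨ regroup (suc p) (x div p) _ (y div p) _ ⟩
  suc p * (x div p + y div p) + (excess p (x % p) + excess p (y % p))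
                                                       ≤⟨ potential-merge p (x div p + y div p) (m%n<n x p) (m%n<n y p) ⟩
  potential p ((x div p + y div p) * p + (x % p + y % p)) ≡⟨ cong (potential p) x+y≡ ⟨
  potential p (x + y)                                  ∎
  where
  open ≤-Reasoning
  regroup : ∀ a M₁ e₁ M₂ e₂ → (a * M₁ + e₁) + (a * M₂ + e₂) ≡ a * (M₁ + M₂) + (e₁ + e₂)
  regroup = solve-∀
  merge : ∀ ρ₁ M₁ ρ₂ M₂ p → (ρ₁ + M₁ * p) + (ρ₂ + M₂ * p) ≡ (M₁ + M₂) * p + (ρ₁ + ρ₂)
  merge = solve-∀
  x+y≡ : x + y ≡ (x div p + y div p) * p + (x % p + y % p)
  x+y≡ = trans (cong₂ _+_ (m≡m%n+[m/n]*n x p) (m≡m%n+[m/n]*n y p)) (merge (x % p) (x div p) (y % p) (y div p) p)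

-- Edge density of subgraphs

-- The right side minus the left side is (p+1)(M+1-p)² + w(M+1-p), which is nonnegative as w ≤ p+1.
square-gap : ∀ p M w → w ≤ suc p →
             (2 * M * p + w + 2 * p) * suc p ≤ (2 + M) * (suc p * M + w) + (p * p + 1) * suc p
square-gap p M w w≤ with p ≤? M
... | yes p≤M with d , refl ← m≤n⇒∃[o]m+o≡n p≤M =
  ≤-trans (m≤m+n _ (suc p * (suc d * suc d) + w * suc d)) (≤-reflexive (above p d w))
  where
  above : ∀ p d w → (2 * (p + d) * p + w + 2 * p) * suc p + (suc p * (suc d * suc d) + w * suc d)
                    ≡ (2 + (p + d)) * (suc p * (p + d) + w) + (p * p + 1) * suc p
  above = solve-∀
... | no p≰M with t , refl ← m≤n⇒∃[o]m+o≡n (≰⇒> p≰M) =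
  +-cancelʳ-≤ (suc p * (t * t)) _ _ (begin
    (2 * M * p + w + 2 * p) * suc p + suc p * (t * t)    ≡⟨ below M t w ⟩
    (2 + M) * (suc p * M + w) + (p * p + 1) * suc p + w * t
      ≤⟨ +-monoʳ-≤ _ (≤-trans (*-monoˡ-≤ t w≤) (*-monoʳ-≤ (suc p) (m≤m*m t))) ⟩
    (2 + M) * (suc p * M + w) + (p * p + 1) * suc p + suc p * (t * t) ∎)
  where
  open ≤-Reasoning
  below : ∀ M t w → let p = suc M + t in
          (2 * M * p + w + 2 * p) * suc p + suc p * (t * t)
          ≡ (2 + M) * (suc p * M + w) + (p * p + 1) * suc p + w * t
  below = solve-∀
  m≤m*m : ∀ m → m ≤ m * m
  m≤m*m zero    = z≤n
  m≤m*m (suc m) = m≤m*n (suc m) (suc m)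

sparse-bound : ∀ {a v M} → v ≤ suc M → 2 * a + v ≤ v * v → 2 * a ≤ v * M
sparse-bound {a} {v} {M} v≤ 2a+v≤v² = +-cancelʳ-≤ v (2 * a) (v * M) (begin
  2 * a + v ≤⟨ 2a+v≤v² ⟩
  v * v     ≤⟨ *-monoʳ-≤ v v≤ ⟩
  v * suc M ≡⟨ *-suc v M ⟩
  v + v * M ≡⟨ +-comm v (v * M) ⟩
  v * M + v ∎)
  where open ≤-Reasoning

dense-bound : ∀ p e M ρ → e + p C 2 ≡ M * p + ρ → ρ < p →
              2 * e * suc p ≤ (2 + M) * (suc p * M + excess p ρ)
dense-bound p e M ρ e+pC2≡ ρ<p = +-cancelʳ-≤ ((p * p + 1) * suc p) _ _ (begin
  2 * e * suc p + (p * p + 1) * suc p             ≡⟨ *-distribʳ-+ (suc p) (2 * e) (p * p + 1) ⟨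
  (2 * e + (p * p + 1)) * suc p                   ≤⟨ *-monoˡ-≤ (suc p) edges≤ ⟩
  (2 * M * p + w + 2 * p) * suc p                 ≤⟨ square-gap p M w (≤-trans (excess≤ ρ<p) (n≤1+n p)) ⟩
  (2 + M) * (suc p * M + w) + (p * p + 1) * suc p ∎)
  where
  open ≤-Reasoning
  w = excess p ρ
  edges≤ : 2 * e + (p * p + 1) ≤ 2 * M * p + w + 2 * p
  edges≤ = begin
    2 * e + (p * p + 1)           ≡⟨ cong (λ q → 2 * e + (q + 1)) (2*nC2+n≡n*n p) ⟨
    2 * e + (2 * (p C 2) + p + 1) ≡⟨ pull e (p C 2) p ⟩
    2 * (e + p C 2) + p + 1       ≡⟨ cong (λ x → 2 * x + p + 1) e+pC2≡ ⟩
    2 * (M * p + ρ) + p + 1       ≡⟨ push M p ρ ⟩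
    2 * M * p + suc (2 * ρ) + p   ≤⟨ +-monoˡ-≤ p (+-monoʳ-≤ (2 * M * p) (m≤n+m∸n (suc (2 * ρ)) p)) ⟩
    2 * M * p + (p + w) + p       ≡⟨ tidy M p w ⟩
    2 * M * p + w + 2 * p         ∎
    where
    pull : ∀ e c p → 2 * e + (2 * c + p + 1) ≡ 2 * (e + c) + p + 1
    pull = solve-∀
    push : ∀ M p ρ → 2 * (M * p + ρ) + p + 1 ≡ 2 * M * p + suc (2 * ρ) + p
    push = solve-∀
    tidy : ∀ M p w → 2 * M * p + (p + w) + p ≡ 2 * M * p + w + 2 * p
    tidy = solve-∀

density≤potential : ∀ p e a v .{{_ : NonZero p}} → a ≤ e → 2 * a + v ≤ v * v →
                    2 * a * suc p ≤ v * potential p (e + p C 2)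
density≤potential p e a v a≤e 2a+v≤v² = by-size (v ≤? suc M)
  where
  open ≤-Reasoning
  x = e + p C 2
  M = x div p
  ρ = x % p
  by-size : Dec (v ≤ suc M) → 2 * a * suc p ≤ v * potential p x
  by-size (yes v≤) = begin
    2 * a * suc p   ≤⟨ *-monoˡ-≤ (suc p) (sparse-bound {a} v≤ 2a+v≤v²) ⟩
    v * M * suc p   ≡⟨ *-assoc v M (suc p) ⟩
    v * (M * suc p) ≡⟨ cong (v *_) (*-comm M (suc p)) ⟩
    v * (suc p * M) ≤⟨ *-monoʳ-≤ v (m≤m+n (suc p * M) (excess p ρ)) ⟩
    v * potential p x ∎
  by-size (no v≰) = begin
    2 * a * suc p           ≤⟨ *-monoˡ-≤ (suc p) (*-monoʳ-≤ 2 a≤e) ⟩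
    2 * e * suc p           ≤⟨ dense-bound p e M ρ (trans (m≡m%n+[m/n]*n x p) (+-comm ρ (M * p))) (m%n<n x p) ⟩
    (2 + M) * potential p x ≤⟨ *-monoˡ-≤ (potential p x) (≰⇒> v≰) ⟩
    v * potential p x       ∎

toℚᵘ-fraction : ∀ a d → ℚ.toℚᵘ ((+ a) / suc d) ℚᵘ.≃ mkℚᵘ (+ a) d
toℚᵘ-fraction a d = ℚP.toℚᵘ-fromℚᵘ (mkℚᵘ (+ a) d)

fraction-≤ : ∀ a b c d .{{_ : NonZero c}} .{{_ : NonZero d}} → a * d ≤ b * c → (+ a) / c ℚ.≤ (+ b) / d
fraction-≤ a b (suc c) (suc d) ad≤bc = ℚP.toℚᵘ-cancel-≤ {(+ a) / suc c} {(+ b) / suc d}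
  (ℚᵘP.≤-respˡ-≃ (ℚᵘP.≃-sym (toℚᵘ-fraction a c))
  (ℚᵘP.≤-respʳ-≃ (ℚᵘP.≃-sym (toℚᵘ-fraction b d))
  (*≤* (subst₂ ℤ._≤_ (pos-* a (suc d)) (pos-* b (suc c)) (ℤ.+≤+ ad≤bc)))))

fraction-mono-≤ : ∀ {a b} d .{{_ : NonZero d}} → a ≤ b → (+ a) / d ℚ.≤ (+ b) / d
fraction-mono-≤ {a} {b} d a≤b = fraction-≤ a b d d (*-monoˡ-≤ d a≤b)

fraction-≡ : ∀ a b c d .{{_ : NonZero c}} .{{_ : NonZero d}} → a * d ≡ b * c → (+ a) / c ≡ (+ b) / d
fraction-≡ a b (suc c) (suc d) ad≡bc =
  ℚP.fromℚᵘ-cong {mkℚᵘ (+ a) c} {mkℚᵘ (+ b) d} (*≡* (trans (sym (pos-* a (suc d))) (trans (cong (+_) ad≡bc) (pos-* b (suc c)))))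

fraction-+ : ∀ a b d .{{_ : NonZero d}} → (+ a) / d ℚ.+ (+ b) / d ≡ (+ (a + b)) / d
fraction-+ a b (suc d) = ℚP.toℚᵘ-injective (begin
  ℚ.toℚᵘ ((+ a) / suc d ℚ.+ (+ b) / suc d)                  ≈⟨ ℚP.toℚᵘ-homo-+ ((+ a) / suc d) ((+ b) / suc d) ⟩
  ℚ.toℚᵘ ((+ a) / suc d) ℚᵘ.+ ℚ.toℚᵘ ((+ b) / suc d)       ≈⟨ ℚᵘP.+-cong (toℚᵘ-fraction a d) (toℚᵘ-fraction b d) ⟩
  mkℚᵘ (+ a) d ℚᵘ.+ mkℚᵘ (+ b) d                          ≈⟨ *≡* same-denominator ⟩
  mkℚᵘ (+ (a + b)) d                                       ≈⟨ toℚᵘ-fraction (a + b) d ⟨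
  ℚ.toℚᵘ ((+ (a + b)) / suc d)                              ∎)
  where
  open ℚᵘP.≃-Reasoning
  distrib : ∀ x y z → (x ℤ.* z ℤ.+ y ℤ.* z) ℤ.* z ≡ (x ℤ.+ y) ℤ.* (z ℤ.* z)
  distrib = ℤ-Solver.solve-∀
  same-denominator : (+ a ℤ.* + suc d ℤ.+ + b ℤ.* + suc d) ℤ.* + suc d ≡ + (a + b) ℤ.* (+ suc d ℤ.* + suc d)
  same-denominator = trans (distrib (+ a) (+ b) (+ suc d)) (cong (ℤ._* (+ suc d ℤ.* + suc d)) (sym (pos-+ a b)))

fraction-difference : ∀ x y z d .{{_ : NonZero d}} → z + y ≡ x * d → (+ x) / 1 - (+ y) / d ≡ (+ z) / d
fraction-difference x y z d z+y≡ = begin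
  (+ x) / 1 - (+ y) / d                  ≡⟨ cong (_- (+ y) / d) (fraction-≡ x (z + y) 1 d (trans (sym z+y≡) (sym (*-identityʳ (z + y))))) ⟩
  (+ (z + y)) / d - (+ y) / d            ≡⟨ cong (_- (+ y) / d) (fraction-+ z y d) ⟨
  ((+ z) / d ℚ.+ (+ y) / d) - (+ y) / d  ≡⟨ ℚP.+-assoc ((+ z) / d) ((+ y) / d) (ℚ.- ((+ y) / d)) ⟩
  (+ z) / d ℚ.+ ((+ y) / d - (+ y) / d)  ≡⟨ cong (ℚ._+_ ((+ z) / d)) (ℚP.+-inverseʳ ((+ y) / d)) ⟩
  (+ z) / d ℚ.+ 0ℚ                       ≡⟨ ℚP.+-identityʳ ((+ z) / d) ⟩
  (+ z) / d                              ∎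
  where open ≡-Reasoning

-- Edge lists

Edge : ℕ → Set
Edge n = Fin n × Fin n

Ordered : ∀ {n} → Edge n → Set
Ordered e = toℕ (proj₁ e) < toℕ (proj₂ e)

lift : ∀ {n} → Edge n → Edge (suc n)
lift (i , j) = inject₁ i , inject₁ j

spoke : ∀ {n} → Fin n → Edge (suc n)
spoke {n} i = inject₁ i , fromℕ n

coneEdges : ∀ {n} → List (Edge n) → List (Fin n) → List (Edge (suc n))
coneEdges es xs = List.map lift es ++ List.map spoke xs

completeEdges : ∀ n → List (Edge n)
completeEdges zero    = []
completeEdges (suc n) = coneEdges (completeEdges n) (allFin n)

coneEdges-ordered : ∀ {n} {es : List (Edge n)} xs → All Ordered es → All Ordered (coneEdges es xs)
coneEdges-ordered {n} xs es-ordered =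
  All.++⁺ (All.map⁺ (All.map lift-ordered es-ordered)) (All.map⁺ (All.tabulate (λ _ → spoke-ordered)))
  where
  lift-ordered : ∀ {e : Edge n} → Ordered e → Ordered (lift e)
  lift-ordered {i , j} = subst₂ _<_ (sym (toℕ-inject₁ i)) (sym (toℕ-inject₁ j))
  spoke-ordered : ∀ {i : Fin n} → Ordered (spoke i)
  spoke-ordered {i} = subst₂ _<_ (sym (toℕ-inject₁ i)) (sym (toℕ-fromℕ n)) (toℕ<n i)

coneEdges-unique : ∀ {n} {es : List (Edge n)} {xs} → Unique es → Unique xs → Unique (coneEdges es xs)
coneEdges-unique {n} {es} {xs} es-unique xs-unique =
  Unique.++⁺ (Unique.map⁺ lift-injective es-unique) (Unique.map⁺ (λ eq → inject₁-injective (cong proj₁ eq)) xs-unique) disjoint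
  where
  lift-injective : ∀ {e e′ : Edge n} → lift e ≡ lift e′ → e ≡ e′
  lift-injective eq = cong₂ _,_ (inject₁-injective (cong proj₁ eq)) (inject₁-injective (cong proj₂ eq))
  disjoint : ∀ {e} → ¬ (e ∈ List.map lift es × e ∈ List.map spoke xs)
  disjoint (∈lifts , ∈spokes) with ∈-map⁻ lift ∈lifts | ∈-map⁻ spoke ∈spokes
  ... | _ , _ , refl | _ , _ , eq = fromℕ≢inject₁ (sym (cong proj₂ eq))

length-coneEdges : ∀ {n} (es : List (Edge n)) xs → length (coneEdges es xs) ≡ length es + length xs
length-coneEdges es xs =
  trans (length-++ (List.map lift es)) (cong₂ _+_ (length-map lift es) (length-map spoke xs))

completeEdges-ordered : ∀ n → All Ordered (completeEdges n)
completeEdges-ordered zero    = []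
completeEdges-ordered (suc n) = coneEdges-ordered (allFin n) (completeEdges-ordered n)

completeEdges-unique : ∀ n → Unique (completeEdges n)
completeEdges-unique zero    = []
completeEdges-unique (suc n) = coneEdges-unique (completeEdges-unique n) (Unique.allFin⁺ n)

length-allFin : ∀ n → length (allFin n) ≡ n
length-allFin n = length-tabulate (λ i → i)

length-completeEdges : ∀ n → length (completeEdges n) ≡ n C 2
length-completeEdges zero    = refl
length-completeEdges (suc n) = begin
  length (completeEdges (suc n))                 ≡⟨ length-coneEdges (completeEdges n) (allFin n) ⟩
  length (completeEdges n) + length (allFin n)   ≡⟨ cong₂ _+_ (length-completeEdges n) (length-allFin n) ⟩
  n C 2 + n                                      ≡⟨ suc[n]C2 n ⟨
  suc n C 2                                      ∎
  where open ≡-Reasoning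

∈-completeEdges : ∀ {n} {e : Edge n} → Ordered e → e ∈ completeEdges n
∈-completeEdges {suc n} {i , j} i<j with view i | view j
... | ‵fromℕ | _ = ⊥-elim (<⇒≱ (subst (_< toℕ j) (toℕ-fromℕ n) i<j) (s≤s⁻¹ (toℕ<n j)))
... | ‵inject₁ i′ | ‵fromℕ = ∈-++⁺ʳ (List.map lift (completeEdges n)) (∈-map⁺ spoke (∈-allFin i′))
... | ‵inject₁ i′ | ‵inject₁ j′ =
  ∈-++⁺ˡ (∈-map⁺ lift (∈-completeEdges (subst₂ _<_ (toℕ-inject₁ i′) (toℕ-inject₁ j′) i<j)))

lookup-injective : ∀ {A : Set} {xs : List A} → Unique xs → ∀ {i j} → List.lookup xs i ≡ List.lookup xs j → i ≡ j
lookup-injective (_ ∷ _)     {Fin.zero}  {Fin.zero}  _  = refl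
lookup-injective (x∉xs ∷ _)  {Fin.zero}  {Fin.suc j} eq = ⊥-elim (All.lookup x∉xs (∈-lookup j) eq)
lookup-injective (x∉xs ∷ _)  {Fin.suc i} {Fin.zero}  eq = ⊥-elim (All.lookup x∉xs (∈-lookup i) (sym eq))
lookup-injective (_ ∷ xs!)   {Fin.suc i} {Fin.suc j} eq = cong Fin.suc (lookup-injective xs! eq)

unique-⊆⇒length≤ : ∀ {A : Set} {xs ys : List A} → Unique xs → All (_∈ ys) xs → length xs ≤ length ys
unique-⊆⇒length≤ {xs = xs} {ys} xs-unique xs⊆ys = injective⇒≤ position-injective
  where
  position : Fin (length xs) → Fin (length ys)
  position i = index (All.lookup xs⊆ys (∈-lookup i))
  position-injective : Injective _≡_ _≡_ position
  position-injective {i} {j} eq = lookup-injective xs-unique (begin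
    List.lookup xs i           ≡⟨ lookup-index (All.lookup xs⊆ys (∈-lookup i)) ⟩
    List.lookup ys (position i) ≡⟨ cong (List.lookup ys) eq ⟩
    List.lookup ys (position j) ≡⟨ lookup-index (All.lookup xs⊆ys (∈-lookup j)) ⟨
    List.lookup xs j           ∎)
    where open ≡-Reasoning

map-unique-on : ∀ {A B : Set} {P : A → Set} (g : A → B) → (∀ {x y} → P x → P y → g x ≡ g y → x ≡ y) →
                ∀ {xs} → All P xs → Unique xs → Unique (List.map g xs)
map-unique-on g injective []         []          = []
map-unique-on g injective (px ∷ pxs) (x∉xs ∷ xs!) =
  All.map⁺ (All.zipWith (λ (x≢y , py) gx≡gy → x≢y (injective px py gx≡gy)) (x∉xs , pxs))
  ∷ map-unique-on g injective pxs xs!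

e≤nC2 : ∀ H → e H ≤ n H C 2
e≤nC2 H = ≤-trans (unique-⊆⇒length≤ (simple H) (All.map ∈-completeEdges (ordered H)))
                  (≤-reflexive (length-completeEdges (n H)))

2e+n≤n*n : ∀ H → 2 * e H + n H ≤ n H * n H
2e+n≤n*n H = ≤-trans (+-monoˡ-≤ (n H) (*-monoʳ-≤ 2 (e≤nC2 H))) (≤-reflexive (2*nC2+n≡n*n (n H)))

orient : ∀ {n} (u v : Fin n) → Dec (toℕ u < toℕ v) → Edge n
orient u v (yes _) = u , v
orient u v (no _)  = v , u

sorted : ∀ {n} → Fin n → Fin n → Edge n
sorted u v = orient u v (toℕ u <? toℕ v)

sorted-≡ : ∀ {n} {u v u′ v′ : Fin n} → sorted u v ≡ sorted u′ v′ → (u ≡ u′ × v ≡ v′) ⊎ (u ≡ v′ × v ≡ u′)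
sorted-≡ {u = u} {v} {u′} {v′} eq with toℕ u <? toℕ v | toℕ u′ <? toℕ v′
... | yes _ | yes _ = inj₁ (cong proj₁ eq , cong proj₂ eq)
... | yes _ | no _  = inj₂ (cong proj₁ eq , cong proj₂ eq)
... | no _  | yes _ = inj₂ (cong proj₂ eq , cong proj₁ eq)
... | no _  | no _  = inj₁ (cong proj₂ eq , cong proj₁ eq)

sorted-∈ : ∀ {n} {es : List (Edge n)} {u v} → All Ordered es → (u , v) ∈ es ⊎ (v , u) ∈ es → sorted u v ∈ es
sorted-∈ {u = u} {v} es-ordered uv∈ with toℕ u <? toℕ v | uv∈
... | yes _   | inj₁ uv = uv
... | yes u<v | inj₂ vu = ⊥-elim (<-asym u<v (All.lookup es-ordered vu))
... | no u≮v  | inj₁ uv = ⊥-elim (u≮v (All.lookup es-ordered uv))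
... | no _    | inj₂ vu = vu

⊆G⇒e≤ : ∀ {H G} → H ⊆G G → e H ≤ e G
⊆G⇒e≤ {H} {G} (f , f-injective , edges∈) = begin
  length (edges H)                  ≡⟨ length-map image (edges H) ⟨
  length (List.map image (edges H)) ≤⟨ unique-⊆⇒length≤ (map-unique-on image image-injective (ordered H) (simple H))
                                                         (All.map⁺ (All.map (sorted-∈ (ordered G)) edges∈)) ⟩
  length (edges G)                  ∎
  where
  open ≤-Reasoning
  image : Edge (n H) → Edge (n G)
  image (i , j) = sorted (f i) (f j)
  image-injective : ∀ {x y} → Ordered x → Ordered y → image x ≡ image y → x ≡ y
  image-injective {i , j} {i′ , j′} i<j i′<j′ eq with sorted-≡ eq
  ... | inj₁ (fi≡ , fj≡) = cong₂ _,_ (f-injective fi≡) (f-injective fj≡)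
  ... | inj₂ (fi≡ , fj≡) =
    ⊥-elim (<-asym i<j (subst₂ _<_ (cong toℕ (sym (f-injective fj≡))) (cong toℕ (sym (f-injective fi≡))) i′<j′))

-- The upper bound

avgDeg≤potential : ∀ p {H G} .{{_ : NonZero p}} (nz : NonZero (n H)) → H ⊆G G →
                   avgDeg H nz ℚ.≤ (+ potential p (e G + p C 2)) / suc p
avgDeg≤potential p {H} {G} nz H⊆G = fraction-≤ (2 * e H) (potential p (e G + p C 2)) (n H) (suc p) {{nz}}
  (≤-trans (density≤potential p (e G) (e H) (n H) (⊆G⇒e≤ {H} {G} H⊆G) (2e+n≤n*n H))
           (≤-reflexive (*-comm (n H) (potential p (e G + p C 2)))))

mad≤potential : ∀ p {G m} .{{_ : NonZero p}} → IsMad G m → m ℚ.≤ (+ potential p (e G + p C 2)) / suc p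
mad≤potential p {G} (_ , inj₁ refl)                 = fraction-≤ 0 (potential p (e G + p C 2)) 1 (suc p) z≤n
mad≤potential p {G} (_ , inj₂ (H , nz , H⊆G , refl)) = avgDeg≤potential p {H} {G} nz H⊆G

sumMad≤potential : ∀ p {k} .{{_ : NonZero p}} (Gs : Vec Graph k) (ms : Vec ℚ k) →
                   (∀ j → IsMad (lookup Gs j) (lookup ms j)) →
                   sumℚ ms ℚ.≤ (+ potential p (totalEdges Gs + k * (p C 2))) / suc p
sumMad≤potential p [] [] _ = fraction-≤ 0 (potential p 0) 1 (suc p) z≤n
sumMad≤potential p {suc k} (G ∷ Gs) (m ∷ ms) mads = begin
  m ℚ.+ sumℚ ms
    ≤⟨ ℚP.+-mono-≤ (mad≤potential p {G} {m} (mads Fin.zero)) (sumMad≤potential p Gs ms (λ j → mads (Fin.suc j))) ⟩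
  (+ potential p x) / suc p ℚ.+ (+ potential p y) / suc p ≡⟨ fraction-+ (potential p x) (potential p y) (suc p) ⟩
  (+ (potential p x + potential p y)) / suc p             ≤⟨ fraction-mono-≤ (suc p) (potential-superadditive p x y) ⟩
  (+ potential p (x + y)) / suc p                         ≡⟨ cong (λ z → (+ potential p z) / suc p) (interleave (e G) (p C 2) (totalEdges Gs) k) ⟩
  (+ potential p (totalEdges (G ∷ Gs) + suc k * (p C 2))) / suc p ∎
  where
  open ℚP.≤-Reasoning
  x = e G + p C 2
  y = totalEdges Gs + k * (p C 2)
  interleave : ∀ a c b k → (a + c) + (b + k * c) ≡ (a + b) + suc k * c
  interleave = solve-∀

-- IsML k N v is by definition MLUpperBound k N v × MLWitness k N v.
MLUpperBound : ℕ → ℕ → ℚ → Set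
MLUpperBound k N v = ∀ (Gs : Vec Graph k) (ms : Vec ℚ k) → totalEdges Gs ≡ N →
                     (∀ j → IsMad (lookup Gs j) (lookup ms j)) → sumℚ ms ℚ.≤ v

MLWitness : ℕ → ℕ → ℚ → Set
MLWitness k N v = Σ (Vec Graph k) λ Gs → Σ (Vec ℚ k) λ ms → totalEdges Gs ≡ N ×
                  (∀ j → IsMad (lookup Gs j) (lookup ms j)) × sumℚ ms ≡ v

ML≤potential : ∀ p k N .{{_ : NonZero p}} → MLUpperBound k N ((+ potential p (N + k * (p C 2))) / suc p)
ML≤potential p k N Gs ms refl mads = sumMad≤potential p Gs ms mads

-- The extremal lists

complete : ℕ → Graph
complete p = record
  { n = p ; edges = completeEdges p ; ordered = completeEdges-ordered p ; simple = completeEdges-unique p }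

cone : ℕ → ℕ → Graph
cone p s = record
  { n       = suc p
  ; edges   = coneEdges (completeEdges p) (take s (allFin p))
  ; ordered = coneEdges-ordered (take s (allFin p)) (completeEdges-ordered p)
  ; simple  = coneEdges-unique (completeEdges-unique p) (Unique.take⁺ s (Unique.allFin⁺ p))
  }

e-cone : ∀ {p s} → s ≤ p → e (cone p s) ≡ p C 2 + s
e-cone {p} {s} s≤p = begin
  length (coneEdges (completeEdges p) (take s (allFin p)))      ≡⟨ length-coneEdges (completeEdges p) (take s (allFin p)) ⟩
  length (completeEdges p) + length (take s (allFin p))         ≡⟨ cong₂ _+_ (length-completeEdges p) (length-take s (allFin p)) ⟩
  p C 2 + s ⊓ length (allFin p)                                 ≡⟨ cong (λ m → p C 2 + s ⊓ m) (length-allFin p) ⟩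
  p C 2 + s ⊓ p                                                 ≡⟨ cong (_+_ (p C 2)) (m≤n⇒m⊓n≡m s≤p) ⟩
  p C 2 + s                                                     ∎
  where open ≡-Reasoning

⊆G-refl : ∀ G → G ⊆G G
⊆G-refl G = (λ i → i) , (λ eq → eq) , All.tabulate inj₁

complete⊆cone : ∀ p s → complete p ⊆G cone p s
complete⊆cone p s = inject₁ , inject₁-injective , All.tabulate (λ e∈ → inj₁ (∈-++⁺ˡ (∈-map⁺ lift e∈)))

fold-excess : ∀ p s .{{_ : NonZero p}} → p ≤ suc (2 * s) → (p ∸ 1) * p + 2 * s ≡ suc p * (p ∸ 1) + excess p s
fold-excess (suc u) s (s≤s u≤2s) = begin
  u * suc u + 2 * s               ≡⟨ cong (_+_ (u * suc u)) (m∸n+n≡m u≤2s) ⟨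
  u * suc u + ((2 * s ∸ u) + u)   ≡⟨ regroup u (2 * s ∸ u) ⟩
  suc (suc u) * u + (2 * s ∸ u)   ∎
  where
  open ≡-Reasoning
  regroup : ∀ u w → u * suc u + (w + u) ≡ suc (suc u) * u + w
  regroup = solve-∀

degree-sum-cone : ∀ {p s} → s ≤ p → 2 * e (cone p s) ≡ (p ∸ 1) * p + 2 * s
degree-sum-cone {p} {s} s≤p = begin
  2 * e (cone p s)      ≡⟨ cong (2 *_) (e-cone s≤p) ⟩
  2 * (p C 2 + s)       ≡⟨ *-distribˡ-+ 2 (p C 2) s ⟩
  2 * (p C 2) + 2 * s   ≡⟨ cong (_+ 2 * s) (2*nC2≡[n∸1]*n p) ⟩
  (p ∸ 1) * p + 2 * s   ∎
  where open ≡-Reasoning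

potential-cone : ∀ p s .{{_ : NonZero p}} → s ≤ p →
                 potential p (e (cone p s) + p C 2) ≡ suc p * (p ∸ 1) + excess p s
potential-cone p s s≤p = begin
  potential p (e (cone p s) + p C 2)   ≡⟨ cong (λ x → potential p (x + p C 2)) (e-cone s≤p) ⟩
  potential p (p C 2 + s + p C 2)      ≡⟨ cong (potential p) (twice (p C 2) s) ⟩
  potential p (2 * (p C 2) + s)        ≡⟨ cong (λ x → potential p (x + s)) (2*nC2≡[n∸1]*n p) ⟩
  potential p ((p ∸ 1) * p + s)        ≡⟨ potential-≡′ p (p ∸ 1) s s≤p ⟩
  suc p * (p ∸ 1) + excess p s         ∎
  where
  open ≡-Reasoning
  twice : ∀ c s → c + s + c ≡ 2 * c + s
  twice = solve-∀

cone-attains : ∀ p s .{{_ : NonZero p}} → s ≤ p →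
               Σ Graph λ H → Σ (NonZero (n H)) λ nz → H ⊆G cone p s × avgDeg H nz ≡ (+ (suc p * (p ∸ 1) + excess p s)) / suc p
cone-attains p s s≤p with p ≤? suc (2 * s)
... | yes p≤2s+1 = cone p s , _ , ⊆G-refl (cone p s) ,
  fraction-≡ (2 * e (cone p s)) (suc p * (p ∸ 1) + excess p s) (suc p) (suc p) (cong (_* suc p) (trans (degree-sum-cone s≤p) (fold-excess p s p≤2s+1)))
... | no p≰2s+1 = complete p , >-nonZero (>-nonZero⁻¹ p) , complete⊆cone p s ,
  fraction-≡ (2 * e (complete p)) (suc p * (p ∸ 1) + excess p s) p (suc p) {{>-nonZero (>-nonZero⁻¹ p)}} (begin
    2 * length (completeEdges p) * suc p   ≡⟨ cong (λ c → 2 * c * suc p) (length-completeEdges p) ⟩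
    2 * (p C 2) * suc p                    ≡⟨ cong (_* suc p) (2*nC2≡[n∸1]*n p) ⟩
    (p ∸ 1) * p * suc p                    ≡⟨ rotate (p ∸ 1) p ⟩
    (suc p * (p ∸ 1) + 0) * p              ≡⟨ cong (λ x → (suc p * (p ∸ 1) + x) * p) (m≤n⇒m∸n≡0 (<⇒≤ (≰⇒> p≰2s+1))) ⟨
    (suc p * (p ∸ 1) + excess p s) * p     ∎)
  where
  open ≡-Reasoning
  rotate : ∀ u p → u * p * suc p ≡ (suc p * u + 0) * p
  rotate = solve-∀

isMad-cone : ∀ p s .{{_ : NonZero p}} → s ≤ p → IsMad (cone p s) ((+ (suc p * (p ∸ 1) + excess p s)) / suc p)
isMad-cone p s s≤p = bounded , inj₂ (cone-attains p s s≤p)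
  where
  bounded : ∀ H nz → H ⊆G cone p s → avgDeg H nz ℚ.≤ (+ (suc p * (p ∸ 1) + excess p s)) / suc p
  bounded H nz H⊆ = subst (λ x → avgDeg H nz ℚ.≤ (+ x) / suc p) (potential-cone p s s≤p)
                          (avgDeg≤potential p {H} {cone p s} nz H⊆)

witness-∷ : ∀ {k N} d G a b .{{_ : NonZero d}} → IsMad G ((+ a) / d) → MLWitness k N ((+ b) / d) →
            MLWitness (suc k) (e G + N) ((+ (a + b)) / d)
witness-∷ d G a b mad (Gs , ms , edges≡ , mads , sum≡) =
  G ∷ Gs , (+ a) / d ∷ ms , cong (_+_ (e G)) edges≡ , (λ { Fin.zero → mad ; (Fin.suc j) → mads j }) ,
  trans (cong (ℚ._+_ ((+ a) / d)) sum≡) (fraction-+ a b d)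

witness-replicate : ∀ d G a .{{_ : NonZero d}} → IsMad G ((+ a) / d) → ∀ t → MLWitness t (t * e G) ((+ (t * a)) / d)
witness-replicate d G a mad zero    = [] , [] , refl , (λ ()) , fraction-≡ 0 0 1 d refl
witness-replicate d G a mad (suc t) = witness-∷ d G a (t * a) mad (witness-replicate d G a mad t)

witness-prepend : ∀ {k N} d G a b .{{_ : NonZero d}} → IsMad G ((+ a) / d) → ∀ q → MLWitness k N ((+ b) / d) →
                  MLWitness (q + k) (q * e G + N) ((+ (q * a + b)) / d)
witness-prepend d G a b mad zero    w = w
witness-prepend {N = N} d G a b mad (suc q) w =
  subst₂ (MLWitness _) (sym (+-assoc (e G) (q * e G) N)) (cong (λ x → (+ x) / d) (sym (+-assoc a (q * a) b)))
    (witness-∷ d G a (q * a + b) mad (witness-prepend d G a b mad q w))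

potential-total : ∀ p {k q r N} .{{_ : NonZero p}} → r < p → N ≡ k * (p C 2) + q * p + r →
                  potential p (N + k * (p C 2)) ≡ suc p * (k * (p ∸ 1) + q) + excess p r
potential-total p {k} {q} {r} {N} r<p N≡ = begin
  potential p (N + k * (p C 2))                        ≡⟨ cong (λ x → potential p (x + k * (p C 2))) N≡ ⟩
  potential p (k * (p C 2) + q * p + r + k * (p C 2))  ≡⟨ cong (potential p) (double k (p C 2) q p r) ⟩
  potential p (k * (2 * (p C 2)) + q * p + r)          ≡⟨ cong (λ x → potential p (k * x + q * p + r)) (2*nC2≡[n∸1]*n p) ⟩
  potential p (k * ((p ∸ 1) * p) + q * p + r)          ≡⟨ cong (potential p) (factor k (p ∸ 1) p q r) ⟩
  potential p ((k * (p ∸ 1) + q) * p + r)              ≡⟨ potential-≡ p (k * (p ∸ 1) + q) r r<p ⟩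
  suc p * (k * (p ∸ 1) + q) + excess p r               ∎
  where
  open ≡-Reasoning
  double : ∀ k c q p r → k * c + q * p + r + k * c ≡ k * (2 * c) + q * p + r
  double = solve-∀
  factor : ∀ k u p q r → k * (u * p) + q * p + r ≡ (k * u + q) * p + r
  factor = solve-∀

extremal-witness : ∀ p {k q r N} .{{_ : NonZero p}} → q < k → r < p → N ≡ k * (p C 2) + q * p + r →
                   MLWitness k N ((+ potential p (N + k * (p C 2))) / suc p)
extremal-witness p {q = q} {r} {N} q<k r<p N≡ with t , refl ← m≤n⇒∃[o]m+o≡n q<k =
  subst₂ (MLWitness (suc q + t)) edges≡ (cong (λ x → (+ x) / suc p) value≡)
    (witness-∷ (suc p) (cone p r) (a r) (q * a p + t * a 0) (isMad-cone p r (<⇒≤ r<p))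
      (witness-prepend (suc p) (cone p p) (a p) (t * a 0) (isMad-cone p p ≤-refl) q
        (witness-replicate (suc p) (cone p 0) (a 0) (isMad-cone p 0 z≤n) t)))
  where
  open ≡-Reasoning
  u = p ∸ 1
  a : ℕ → ℕ
  a s = suc p * u + excess p s
  edges≡ : e (cone p r) + (q * e (cone p p) + t * e (cone p 0)) ≡ N
  edges≡ = begin
    e (cone p r) + (q * e (cone p p) + t * e (cone p 0))
      ≡⟨ cong₂ (λ x y → e (cone p r) + (q * x + t * y)) (e-cone {p} ≤-refl) (e-cone {p} z≤n) ⟩
    e (cone p r) + (q * (p C 2 + p) + t * (p C 2 + 0)) ≡⟨ cong (λ x → x + _) (e-cone (<⇒≤ r<p)) ⟩
    p C 2 + r + (q * (p C 2 + p) + t * (p C 2 + 0))    ≡⟨ collect (p C 2) r q p t ⟩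
    (suc q + t) * (p C 2) + q * p + r                 ≡⟨ N≡ ⟨
    N                                                 ∎
    where
    collect : ∀ c r q p t → c + r + (q * (c + p) + t * (c + 0)) ≡ (suc q + t) * c + q * p + r
    collect = solve-∀
  value≡ : suc p * u + excess p r + (q * (suc p * u + excess p p) + t * (suc p * u + excess p 0))
           ≡ potential p (N + (suc q + t) * (p C 2))
  value≡ = begin
    suc p * u + excess p r + (q * (suc p * u + excess p p) + t * (suc p * u + excess p 0))
      ≡⟨ cong₂ (λ x y → suc p * u + excess p r + (q * (suc p * u + x) + t * (suc p * u + y))) (excess-self p) (excess-zero p) ⟩
    suc p * u + excess p r + (q * (suc p * u + suc p) + t * (suc p * u + 0))
      ≡⟨ collect (suc p) u (excess p r) q t ⟩
    suc p * ((suc q + t) * u + q) + excess p r     ≡⟨ potential-total p {suc q + t} r<p N≡ ⟨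
    potential p (N + (suc q + t) * (p C 2))        ∎
    where
    collect : ∀ P u x q t → P * u + x + (q * (P * u + P) + t * (P * u + 0)) ≡ P * ((suc q + t) * u + q) + x
    collect = solve-∀

isML-closed-form : ∀ p {k q r N} .{{_ : NonZero p}} → q < k → r < p → N ≡ k * (p C 2) + q * p + r →
                   IsML k N ((+ (suc p * (k * (p ∸ 1) + q) + excess p r)) / suc p)
isML-closed-form p {k} {q} {r} {N} q<k r<p N≡ =
  subst (IsML k N) (cong (λ x → (+ x) / suc p) (potential-total p {k} r<p N≡))
    (ML≤potential p k N , extremal-witness p {k} {q} {r} {N} q<k r<p N≡)

excess-complement : ∀ {p r} → r < p → p ≤ suc (2 * r) → excess p r + 2 * (p ∸ r) ≡ suc p
excess-complement {p} {r} r<p p≤2r+1 = +-cancelʳ-≡ p _ _ (begin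
  excess p r + 2 * (p ∸ r) + p   ≡⟨ swap (excess p r) (p ∸ r) p ⟩
  excess p r + p + 2 * (p ∸ r)   ≡⟨ cong (_+ 2 * (p ∸ r)) (m∸n+n≡m p≤2r+1) ⟩
  suc (2 * r) + 2 * (p ∸ r)      ≡⟨ merge r (p ∸ r) ⟩
  suc (2 * (p ∸ r + r))          ≡⟨ cong (λ x → suc (2 * x)) (m∸n+n≡m (<⇒≤ r<p)) ⟩
  suc (2 * p)                    ≡⟨ halve p ⟩
  suc p + p                      ∎)
  where
  open ≡-Reasoning
  swap : ∀ w u p → w + 2 * u + p ≡ w + p + 2 * u
  swap = solve-∀
  merge : ∀ r u → suc (2 * r) + 2 * u ≡ suc (2 * (u + r))
  merge = solve-∀
  halve : ∀ p → suc (2 * p) ≡ suc p + p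
  halve = solve-∀

small-remainder-value : ∀ p A {r} .{{_ : NonZero p}} → 2 * r ≤ p ∸ 1 → (+ (suc p * A + excess p r)) / suc p ≡ (+ A) / 1
small-remainder-value (suc u) A {r} 2r≤u = fraction-≡ (suc (suc u) * A + excess (suc u) r) A (suc (suc u)) 1 (begin
  (suc (suc u) * A + (2 * r ∸ u)) * 1 ≡⟨ cong (λ x → (suc (suc u) * A + x) * 1) (m≤n⇒m∸n≡0 2r≤u) ⟩
  (suc (suc u) * A + 0) * 1           ≡⟨ rotate (suc (suc u)) A ⟩
  A * suc (suc u)                     ∎)
  where
  open ≡-Reasoning
  rotate : ∀ P A → (P * A + 0) * 1 ≡ A * P
  rotate = solve-∀

large-remainder-value : ∀ p A {r} .{{_ : NonZero p}} → r < p → p ∸ 1 ≤ 2 * r →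
                        (+ (suc p * A + excess p r)) / suc p ≡ (+ (A + 1)) / 1 - (+ (2 * (p ∸ r))) / suc p
large-remainder-value p@(suc _) A {r} r<p u≤2r = sym (fraction-difference (A + 1) (2 * (p ∸ r)) (suc p * A + excess p r) (suc p) (begin
  suc p * A + excess p r + 2 * (p ∸ r)   ≡⟨ +-assoc (suc p * A) (excess p r) (2 * (p ∸ r)) ⟩
  suc p * A + (excess p r + 2 * (p ∸ r)) ≡⟨ cong (_+_ (suc p * A)) (excess-complement r<p (s≤s u≤2r)) ⟩
  suc p * A + suc p                      ≡⟨ rotate (suc p) A ⟩
  (A + 1) * suc p                        ∎))
  where
  open ≡-Reasoning
  rotate : ∀ P A → P * A + P ≡ (A + 1) * P
  rotate = solve-∀

k*p∸k≡k*[p∸1] : ∀ k p → k * p ∸ k ≡ k * (p ∸ 1)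
k*p∸k≡k*[p∸1] k p = trans (cong (k * p ∸_) (sym (*-identityʳ k))) (sym (*-distribˡ-∸ k p 1))

theorem5p1 : (k N p q r : ℕ) → 2 ≤ k → k ≤ N → 2 ≤ p →
    k * (p C 2) ≤ N → N < k * (suc p C 2) →
    N ≡ k * (p C 2) + q * p + r → q < k → r < p →
    (2 * r ≤ p ∸ 1 → IsML k N ((+ (k * p ∸ k + q)) / 1)) ×
    (p ∸ 1 ≤ 2 * r →
      IsML k N ((+ (k * p ∸ k + q + 1)) / 1 - (+ (2 * (p ∸ r))) / suc p))
theorem5p1 k N zero    q r _ _ () _ _ _ _ _
theorem5p1 k N p@(suc _) q r _ _ _ _ _ N≡ q<k r<p rewrite k*p∸k≡k*[p∸1] k p =
    (λ 2r≤p∸1 → subst (IsML k N) (small-remainder-value p A {r} 2r≤p∸1) ML)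
  , (λ p∸1≤2r → subst (IsML k N) (large-remainder-value p A r<p p∸1≤2r) ML)
  where
  A = k * (p ∸ 1) + q
  ML : IsML k N ((+ (suc p * A + excess p r)) / suc p)
  ML = isML-closed-form p q<k r<p N≡
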